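{- Let $(\Sigma,<)$ be a finite totally ordered alphabet and let $\ell_1,\ldots,\ell_h$ be anti-Lyndon words with $\ell_1\ge_p\ell_2\ge_p\cdots\ge_p\ell_h$. Let $h\ge2$ and let $i,j$ with $1\le i<j<h$ be such that $\ell_1=\ell_2=\cdots=\ell_i\neq\ell_{i+1}$ and $\ell_{i+1}\cdots\ell_j$ is a prefix of $\ell_1$. If $\ell_{i+1}\cdots\ell_{j+1}$ is not a prefix of $\ell_1$, then $\ell_1\ll\ell_{i+1}\cdots\ell_{j+1}$. More specifically, there are words $r,s,s'\in\Sigma^*$ and letters $a,b\in\Sigma$ with $a<b$ such that $\ell_1=\ell_{i+1}\cdots\ell_j\,ras$ and $\ell_{j+1}=rbs'$.
   Context: $x\ge_p y$ means $y$ is a prefix of $x$. Lexicographic order $\prec$ on $\Sigma^*$: $x\prec y$ if $x$ is a proper prefix of $y$, or $x=ras$, $y=rbt$ with $a,b\in\Sigma$, $a<b$. For nonempty $x,y$, $x\ll y$ means $x\prec y$ and $x$ is not a proper prefix of $y$. Inverse order $<_{in}$: $b<_{in}a\iff a<b$; $\prec_{in}$ the induced lexicographic order. An anti-Lyndon word is a nonempty primitive word strictly smaller for $\prec_{in}$ than all its other conjugates. -}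

module Defs where

open import Data.Nat using (ℕ; zero; suc; _≤_)
open import Data.Fin using (Fin) renaming (_<_ to _<F_)
open import Data.List using (List; []; _∷_; _++_; concat; replicate)
open import Data.Product using (Σ; ∃; _×_; _,_)
open import Data.Sum using (_⊎_)
open import Relation.Binary.PropositionalEquality using (_≡_; _≢_)
open import Relation.Nullary using (¬_)

-- The finite totally ordered alphabet Σ is modelled as Fin k with its usual order
-- (every finite totally ordered set is order-isomorphic to such a Fin k).
Word : ℕ → Set
Word k = List (Fin k)

module _ {k : ℕ} where

  -- y is a prefix of x   (x ≥_p y)
  Prefix : Word k → Word k → Set
  Prefix y x = ∃ λ z → x ≡ y ++ z

  ProperPrefix : Word k → Word k → Set
  ProperPrefix y x = Σ (Fin k) λ c → Σ (Word k) λ z → x ≡ y ++ (c ∷ z)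

  NonEmpty : Word k → Set
  NonEmpty x = Σ (Fin k) λ c → Σ (Word k) λ z → x ≡ c ∷ z

  Lex : (Fin k → Fin k → Set) → Word k → Word k → Set
  Lex _<ₗ_ x y =
    ProperPrefix x y
    ⊎ (Σ (Word k) λ r → Σ (Fin k) λ a → Σ (Fin k) λ b → Σ (Word k) λ s → Σ (Word k) λ t →
          (a <ₗ b) × (x ≡ r ++ (a ∷ s)) × (y ≡ r ++ (b ∷ t)))

  _≺_ : Word k → Word k → Set
  _≺_ = Lex _<F_

  _<in_ : Fin k → Fin k → Set
  b <in a = a <F b

  _≺in_ : Word k → Word k → Set
  _≺in_ = Lex _<in_

  _≪_ : Word k → Word k → Set
  x ≪ y = NonEmpty x × NonEmpty y × (x ≺ y) × ¬ ProperPrefix x y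

  pow : Word k → ℕ → Word k
  pow u n = concat (replicate n u)

  Primitive : Word k → Set
  Primitive w = ∀ (u : Word k) (n : ℕ) → w ≡ pow u n → n ≡ 1

  Conjugate : Word k → Word k → Set
  Conjugate v w = Σ (Word k) λ u → Σ (Word k) λ t → (w ≡ u ++ t) × (v ≡ t ++ u)

  AntiLyndon : Word k → Set
  AntiLyndon w = NonEmpty w × Primitive w ×
    (∀ v → Conjugate v w → v ≢ w → w ≺in v)

  -- seg ℓ a n = ℓ_a ℓ_{a+1} ⋯ ℓ_{a+n-1}
  seg : (ℕ → Word k) → ℕ → ℕ → Word k
  seg ℓ a zero = []
  seg ℓ a (suc n) = ℓ a ++ seg ℓ (suc a) n

{-# OPTIONS --safe #-}
module Submission where

-- An anti-Lyndon word is unbordered: a border y (w = y u = v y) either makes w = y u = u y a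
-- proper power, or u and v first differ at letters a ≠ b, and then the conjugates y v and u y of w
-- force both a <_in b and b <_in a.  Write ℓ₁ = P w with P = ℓ_{i+1} ⋯ ℓ_j and X = ℓ_{j+1}, a prefix
-- of ℓ₁.  The word w is nonempty, since otherwise ℓ₁ = ℓ_{i+1} or ℓ₁ ends with its own prefix ℓ_j.
-- X cannot be a prefix of w (PX is no prefix of ℓ₁), nor w a prefix of X (w would be a border), so
-- w = r a s and X = r b s' with a ≠ b; comparing ℓ₁ = r b ⋯ with its conjugate w P = r a ⋯ gives a < b.

open import Defs
open import Data.Nat using (ℕ; zero; suc; _≤_; _<_; _∸_; _+_; z≤n; s≤s)
open import Data.Nat.Properties
  using (≤-refl; ≤-trans; <⇒≤; ≤-pred; m≤m+n; +-suc; +-comm; +-identityʳ; +-cancelˡ-≡; +-∸-assoc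
        ; m+[n∸m]≡n; m<n⇒0<n∸m; m+1+n≢0; m+1+n≢m; suc-injective)
open import Data.Nat.Induction using (<-wellFounded)
open import Induction.WellFounded using (Acc; acc)
open import Data.Fin using (Fin) renaming (_<_ to _<F_)
open import Data.Fin.Properties using (_≟_; <-irrefl; <-asym)
open import Data.Product using (Σ; ∃-syntax; _×_; _,_; proj₁; proj₂; map₁)
open import Data.Sum using (_⊎_; inj₁; inj₂)
open import Data.List using ([]; _∷_; _++_; length)
open import Data.List.Properties
  using (++-assoc; ++-identityʳ; ++-cancelˡ; length-++; length-++-comm; ∷-injective; ∷-injectiveˡ; ∷-injectiveʳ)
open import Data.Empty using (⊥; ⊥-elim)
open import Function using (_∘_)
open import Relation.Binary.Definitions using (Irreflexive; Asymmetric)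
import Relation.Binary.Construct.Flip.EqAndOrd as Flip
open import Relation.Binary.PropositionalEquality
open import Relation.Nullary using (¬_; yes; no)

module _ {k : ℕ} where

  ConjugateMinimal : (Fin k → Fin k → Set) → Word k → Set
  ConjugateMinimal R w = ∀ v → Conjugate v w → v ≢ w → Lex R w v

  -- AntiLyndon is definitionally Lyndon _<in_.
  Lyndon : (Fin k → Fin k → Set) → Word k → Set
  Lyndon R w = NonEmpty w × Primitive w × ConjugateMinimal R w

  Mismatch : Word k → Word k → Set
  Mismatch x y = ∃[ r ] ∃[ a ] ∃[ b ] ∃[ s ] ∃[ t ] a ≢ b × x ≡ r ++ a ∷ s × y ≡ r ++ b ∷ t

  ¬NonEmpty[] : ¬ NonEmpty {k} []
  ¬NonEmpty[] (_ , _ , ())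

  NonEmpty-++ : ∀ {x : Word k} y → NonEmpty x → NonEmpty (x ++ y)
  NonEmpty-++ y (c , z , refl) = c , z ++ y , refl

  NonEmpty-++-∷ : ∀ (r : Word k) a s → NonEmpty (r ++ a ∷ s)
  NonEmpty-++-∷ []      a s = a , s , refl
  NonEmpty-++-∷ (c ∷ r) a s = c , r ++ a ∷ s , refl

  Prefix-refl : ∀ {x : Word k} → Prefix x x
  Prefix-refl {x} = [] , sym (++-identityʳ x)

  Prefix-trans : ∀ {x y z : Word k} → Prefix x y → Prefix y z → Prefix x z
  Prefix-trans {x} (m , refl) (n , refl) = m ++ n , ++-assoc x m n

  Prefix-≢⇒ProperPrefix : ∀ {x y : Word k} → Prefix y x → x ≢ y → ProperPrefix y x
  Prefix-≢⇒ProperPrefix {y = y} ([] , x≡y[]) x≢y = ⊥-elim (x≢y (trans x≡y[] (++-identityʳ y)))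
  Prefix-≢⇒ProperPrefix (c ∷ z , x≡ycz) _ = c , z , x≡ycz

  Prefix-length-≡ : ∀ {x y : Word k} → Prefix x y → length x ≡ length y → x ≡ y
  Prefix-length-≡ {x} ([] , y≡x[]) _ = sym (trans y≡x[] (++-identityʳ x))
  Prefix-length-≡ {x} (c ∷ m , refl) |x|≡|y| = ⊥-elim (m+1+n≢m (length x) (sym (trans |x|≡|y| (length-++ x))))

  ++-∷-injectiveˡ : ∀ (r : Word k) {a b s t} → r ++ a ∷ s ≡ r ++ b ∷ t → a ≡ b
  ++-∷-injectiveˡ r eq = ∷-injectiveˡ (++-cancelˡ r _ _ eq)

  ProperPrefix⇒≡ : ∀ (r : Word k) {a b s t} → ProperPrefix (r ++ a ∷ s) (r ++ b ∷ t) → a ≡ b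
  ProperPrefix⇒≡ r {a} {s = s} (c , z , eq) =
    ++-∷-injectiveˡ r (trans (sym (++-assoc r (a ∷ s) (c ∷ z))) (sym eq))

  ++-equidivisible : ∀ (x y u v : Word k) → x ++ y ≡ u ++ v →
    (∃[ m ] u ≡ x ++ m × y ≡ m ++ v) ⊎ (∃[ m ] x ≡ u ++ m × v ≡ m ++ y)
  ++-equidivisible []      y u       v eq = inj₁ (u , refl , eq)
  ++-equidivisible (a ∷ x) y []      v eq = inj₂ (a ∷ x , refl , sym eq)
  ++-equidivisible (a ∷ x) y (b ∷ u) v eq with ∷-injective eq
  ... | refl , eq′ with ++-equidivisible x y u v eq′
  ...   | inj₁ (m , u≡xm , y≡mv) = inj₁ (m , cong (a ∷_) u≡xm , y≡mv)
  ...   | inj₂ (m , x≡um , v≡my) = inj₂ (m , cong (a ∷_) x≡um , v≡my)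

  length-<-++ : ∀ (x : Word k) {y} → NonEmpty y → length x < length (x ++ y)
  length-<-++ []      (c , z , refl) = s≤s z≤n
  length-<-++ (a ∷ x) ne-y           = s≤s (length-<-++ x ne-y)

  pow-+ : ∀ (t : Word k) p q → pow t (p + q) ≡ pow t p ++ pow t q
  pow-+ t zero    q = refl
  pow-+ t (suc p) q = trans (cong (t ++_) (pow-+ t p q)) (sym (++-assoc t (pow t p) (pow t q)))

  commuting⇒powers : ∀ (x y : Word k) → Acc _<_ (length (x ++ y)) → x ++ y ≡ y ++ x →
    ∃[ t ] ∃[ p ] ∃[ q ] x ≡ pow t p × y ≡ pow t q
  commuting⇒powers [] y _ _ = y , 0 , 1 , refl , sym (++-identityʳ y)
  commuting⇒powers x [] _ _ = x , 1 , 0 , sym (++-identityʳ x) , refl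
  commuting⇒powers x@(a ∷ x′) y@(b ∷ y′) (acc rec) xy≡yx with ++-equidivisible x y y x xy≡yx
  ... | inj₁ (m , y≡xm , y≡mx) =
    let shorter = subst (_< length (x ++ y)) (cong length y≡xm)
                    (subst (length y <_) (length-++-comm y x) (length-<-++ y (a , x′ , refl)))
        t , p , q , x≡tᵖ , m≡tᵠ = commuting⇒powers x m (rec shorter) (trans (sym y≡xm) y≡mx)
    in t , p , p + q , x≡tᵖ , trans y≡xm (trans (cong₂ _++_ x≡tᵖ m≡tᵠ) (sym (pow-+ t p q)))
  ... | inj₂ (m , x≡ym , x≡my) =
    let shorter = subst (_< length (x ++ y)) (cong length x≡my) (length-<-++ x (b , y′ , refl))
        t , p , q , m≡tᵖ , y≡tᵠ = commuting⇒powers m y (rec shorter) (trans (sym x≡my) x≡ym)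
    in t , p + q , q , trans x≡my (trans (cong₂ _++_ m≡tᵖ y≡tᵠ) (sym (pow-+ t p q))) , y≡tᵠ

  commuting⇒¬Primitive : ∀ {x y : Word k} → NonEmpty x → NonEmpty y → x ++ y ≡ y ++ x → ¬ Primitive (x ++ y)
  commuting⇒¬Primitive {x} {y} ne-x ne-y xy≡yx prim
    with commuting⇒powers x y (<-wellFounded _) xy≡yx
  ... | t , zero  , q     , refl , _    = ¬NonEmpty[] ne-x
  ... | t , suc p , zero  , _    , refl = ¬NonEmpty[] ne-y
  ... | t , suc p , suc q , refl , refl =
    m+1+n≢0 p (suc-injective (prim t (suc p + suc q) (sym (pow-+ t (suc p) (suc q)))))

  ∷-Mismatch : ∀ c {x y : Word k} → Mismatch x y → Mismatch (c ∷ x) (c ∷ y)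
  ∷-Mismatch c (r , a , b , s , t , a≢b , refl , refl) = c ∷ r , a , b , s , t , a≢b , refl , refl

  prefix-or-mismatch : ∀ (x y : Word k) → Prefix x y ⊎ Prefix y x ⊎ Mismatch x y
  prefix-or-mismatch []      y       = inj₁ (y , refl)
  prefix-or-mismatch (c ∷ x) []      = inj₂ (inj₁ (c ∷ x , refl))
  prefix-or-mismatch (c ∷ x) (d ∷ y) with c ≟ d
  ... | no c≢d = inj₂ (inj₂ ([] , c , d , x , y , c≢d , refl , refl))
  ... | yes refl with prefix-or-mismatch x y
  ...   | inj₁ (m , refl)         = inj₁ (m , refl)
  ...   | inj₂ (inj₁ (m , refl))  = inj₂ (inj₁ (m , refl))
  ...   | inj₂ (inj₂ x≠y)         = inj₂ (inj₂ (∷-Mismatch c x≠y))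

  ≡-or-mismatch : ∀ {x y : Word k} → length x ≡ length y → x ≡ y ⊎ Mismatch x y
  ≡-or-mismatch {x} {y} |x|≡|y| with prefix-or-mismatch x y
  ... | inj₁ x⊑y        = inj₁ (Prefix-length-≡ x⊑y |x|≡|y|)
  ... | inj₂ (inj₁ y⊑x) = inj₁ (sym (Prefix-length-≡ y⊑x (sym |x|≡|y|)))
  ... | inj₂ (inj₂ x≠y) = inj₂ x≠y

  mismatch-letters-unique : ∀ (r r′ : Word k) {a b a′ b′ s t s′ t′} →
    r ++ a ∷ s ≡ r′ ++ a′ ∷ s′ → r ++ b ∷ t ≡ r′ ++ b′ ∷ t′ → a ≢ b → a′ ≢ b′ → a ≡ a′ × b ≡ b′
  mismatch-letters-unique []      []       eq₁ eq₂ _   _     = ∷-injectiveˡ eq₁ , ∷-injectiveˡ eq₂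
  mismatch-letters-unique []      (c ∷ r′) eq₁ eq₂ a≢b _     =
    ⊥-elim (a≢b (trans (∷-injectiveˡ eq₁) (sym (∷-injectiveˡ eq₂))))
  mismatch-letters-unique (c ∷ r) []       eq₁ eq₂ _   a′≢b′ =
    ⊥-elim (a′≢b′ (trans (sym (∷-injectiveˡ eq₁)) (∷-injectiveˡ eq₂)))
  mismatch-letters-unique (c ∷ r) (c′ ∷ r′) eq₁ eq₂ a≢b a′≢b′ =
    mismatch-letters-unique r r′ (∷-injectiveʳ eq₁) (∷-injectiveʳ eq₂) a≢b a′≢b′

  Lex-mismatch : ∀ {R : Fin k → Fin k → Set} → Irreflexive _≡_ R →
    ∀ {x y} r {a b s t} → x ≡ r ++ a ∷ s → y ≡ r ++ b ∷ t → a ≢ b → Lex R x y → R a b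
  Lex-mismatch irrefl r refl refl a≢b (inj₁ x⊏y) = ⊥-elim (a≢b (ProperPrefix⇒≡ r x⊏y))
  Lex-mismatch irrefl r x≡ras y≡rbt a≢b (inj₂ (r′ , a′ , b′ , s′ , t′ , Ra′b′ , x≡ , y≡))
    with mismatch-letters-unique r r′ (trans (sym x≡ras) x≡) (trans (sym y≡rbt) y≡) a≢b (λ a′≡b′ → irrefl a′≡b′ Ra′b′)
  ... | refl , refl = Ra′b′

  ConjugateMinimal-mismatch : ∀ {R : Fin k → Fin k → Set} {w} → Irreflexive _≡_ R → ConjugateMinimal R w →
    ∀ x y r {a b s t} → w ≡ x ++ y → w ≡ r ++ b ∷ s → y ++ x ≡ r ++ a ∷ t → a ≢ b → R b a
  ConjugateMinimal-mismatch {w = w} irrefl minimal x y r w≡xy w≡rbs yx≡rat a≢b =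
    Lex-mismatch irrefl r w≡rbs yx≡rat (a≢b ∘ sym) (minimal (y ++ x) (x , y , w≡xy , refl) yx≢w)
    where
    yx≢w : y ++ x ≢ w
    yx≢w yx≡w = a≢b (++-∷-injectiveˡ r (trans (sym yx≡rat) (trans yx≡w w≡rbs)))

  border-length : ∀ {y u v : Word k} → y ++ u ≡ v ++ y → length u ≡ length v
  border-length {y} {u} {v} yu≡vy = +-cancelˡ-≡ (length y) _ _ (begin
    length y + length u  ≡⟨ length-++ y ⟨
    length (y ++ u)      ≡⟨ cong length yu≡vy ⟩
    length (v ++ y)      ≡⟨ length-++ v ⟩
    length v + length y  ≡⟨ +-comm (length v) (length y) ⟩
    length y + length v  ∎)
    where open ≡-Reasoning

  Lyndon⇒unbordered : ∀ {R : Fin k → Fin k → Set} {w y u v} → Irreflexive _≡_ R → Asymmetric R → Lyndon R w →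
    NonEmpty y → NonEmpty v → w ≡ y ++ u → w ≡ v ++ y → ⊥
  Lyndon⇒unbordered {R} {w} {y} {u} {v} irrefl asym (_ , prim , minimal) ne-y ne-v w≡yu w≡vy
    with ≡-or-mismatch {u} {v} (border-length {y} (trans (sym w≡yu) w≡vy))
  ... | inj₁ refl = commuting⇒¬Primitive ne-y ne-v (trans (sym w≡yu) w≡vy) (subst Primitive w≡yu prim)
  ... | inj₂ (r , a , b , s , t , a≢b , refl , refl) = asym Rab Rba
    where
    Rba : R b a
    Rba = ConjugateMinimal-mismatch irrefl minimal y (r ++ a ∷ s) r
            w≡yu (trans w≡vy (++-assoc r (b ∷ t) y)) (++-assoc r (a ∷ s) y) a≢b
    Rab : R a b
    Rab = ConjugateMinimal-mismatch irrefl minimal (r ++ b ∷ t) y (y ++ r)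
            w≡vy (trans w≡yu (sym (++-assoc y r (a ∷ s)))) (sym (++-assoc y r (b ∷ t))) (a≢b ∘ sym)

  Lyndon-overlap-mismatch : ∀ {R : Fin k → Fin k → Set} {L P X} → Irreflexive _≡_ R → Asymmetric R → Lyndon R L →
    NonEmpty P → ProperPrefix P L → Prefix X L → ¬ Prefix (P ++ X) L →
    ∃[ r ] ∃[ s ] ∃[ s′ ] ∃[ a ] ∃[ b ] R b a × L ≡ P ++ (r ++ a ∷ s) × X ≡ r ++ b ∷ s′
  Lyndon-overlap-mismatch {R} {P = P} {X} irrefl asym lyndon@(_ , _ , minimal) ne-P (c , z , L≡Pw) (n , L≡Xn) PX⋢L
    with prefix-or-mismatch (c ∷ z) X
  ... | inj₁ (m , X≡wm) =
    ⊥-elim (Lyndon⇒unbordered irrefl asym lyndon (c , z , refl) ne-P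
              (trans L≡Xn (trans (cong (_++ n) X≡wm) (++-assoc (c ∷ z) m n))) L≡Pw)
  ... | inj₂ (inj₁ (m , w≡Xm)) =
    ⊥-elim (PX⋢L (m , trans L≡Pw (trans (cong (P ++_) w≡Xm) (sym (++-assoc P X m)))))
  ... | inj₂ (inj₂ (r , a , b , s , s′ , a≢b , w≡ras , refl)) =
    r , s , s′ , a , b , Rba , trans L≡Pw (cong (P ++_) w≡ras) , refl
    where
    Rba : R b a
    Rba = ConjugateMinimal-mismatch irrefl minimal P (c ∷ z) r L≡Pw (trans L≡Xn (++-assoc r (b ∷ s′) n))
            (trans (cong (_++ P) w≡ras) (++-assoc r (a ∷ s) P)) a≢b

  mismatch⇒≪ : ∀ {x y : Word k} r {a b s t} → a <F b → x ≡ r ++ a ∷ s → y ≡ r ++ b ∷ t → x ≪ y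
  mismatch⇒≪ r {a} {b} {s} {t} a<b refl refl =
    NonEmpty-++-∷ r a s , NonEmpty-++-∷ r b t , inj₂ (r , a , b , s , t , a<b , refl , refl) ,
    λ x⊏y → <-irrefl (ProperPrefix⇒≡ r x⊏y) a<b

  <in-irrefl : Irreflexive _≡_ (_<in_ {k})
  <in-irrefl = Flip.irrefl _<F_ sym <-irrefl

  <in-asym : Asymmetric (_<in_ {k})
  <in-asym = Flip.asym _<F_ <-asym

  AntiLyndon⇒unbordered : ∀ {w y u v : Word k} → AntiLyndon w → NonEmpty y → NonEmpty v → w ≡ y ++ u → w ≡ v ++ y → ⊥
  AntiLyndon⇒unbordered = Lyndon⇒unbordered <in-irrefl <in-asym

  AntiLyndon-overlap : ∀ {L P X : Word k} → AntiLyndon L →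
    NonEmpty P → ProperPrefix P L → Prefix X L → ¬ Prefix (P ++ X) L →
    (L ≪ (P ++ X)) × (∃[ r ] ∃[ s ] ∃[ s′ ] ∃[ a ] ∃[ b ] a <F b × L ≡ P ++ (r ++ a ∷ s) × X ≡ r ++ b ∷ s′)
  AntiLyndon-overlap {P = P} anti-Lyndon ne-P P⊏L X⊑L PX⋢L
    with Lyndon-overlap-mismatch <in-irrefl <in-asym anti-Lyndon ne-P P⊏L X⊑L PX⋢L
  ... | r , s , s′ , a , b , a<b , L≡Pras , refl =
    mismatch⇒≪ (P ++ r) a<b (trans L≡Pras (sym (++-assoc P r (a ∷ s)))) (sym (++-assoc P r (b ∷ s′))) ,
    r , s , s′ , a , b , a<b , L≡Pras , refl

  seg-snoc : ∀ (ℓ : ℕ → Word k) a n → seg ℓ a (suc n) ≡ seg ℓ a n ++ ℓ (a + n)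
  seg-snoc ℓ a zero    = trans (++-identityʳ (ℓ a)) (cong ℓ (sym (+-identityʳ a)))
  seg-snoc ℓ a (suc n) = begin
    ℓ a ++ seg ℓ (suc a) (suc n)               ≡⟨ cong (ℓ a ++_) (seg-snoc ℓ (suc a) n) ⟩
    ℓ a ++ (seg ℓ (suc a) n ++ ℓ (suc a + n))  ≡⟨ ++-assoc (ℓ a) (seg ℓ (suc a) n) _ ⟨
    seg ℓ a (suc n) ++ ℓ (suc a + n)           ≡⟨ cong (λ m → seg ℓ a (suc n) ++ ℓ m) (+-suc a n) ⟨
    seg ℓ a (suc n) ++ ℓ (a + suc n)           ∎
    where open ≡-Reasoning

  seg-∸-snoc : ∀ (ℓ : ℕ → Word k) {i j} → i ≤ j → seg ℓ (suc i) (suc j ∸ i) ≡ seg ℓ (suc i) (j ∸ i) ++ ℓ (suc j)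
  seg-∸-snoc ℓ {i} {j} i≤j = begin
    seg ℓ (suc i) (suc j ∸ i)                     ≡⟨ cong (seg ℓ (suc i)) (+-∸-assoc 1 i≤j) ⟩
    seg ℓ (suc i) (suc (j ∸ i))                   ≡⟨ seg-snoc ℓ (suc i) (j ∸ i) ⟩
    seg ℓ (suc i) (j ∸ i) ++ ℓ (suc i + (j ∸ i))  ≡⟨ cong (λ m → seg ℓ (suc i) (j ∸ i) ++ ℓ (suc m)) (m+[n∸m]≡n i≤j) ⟩
    seg ℓ (suc i) (j ∸ i) ++ ℓ (suc j)            ∎
    where open ≡-Reasoning

  seg-NonEmpty : ∀ (ℓ : ℕ → Word k) a {n} → NonEmpty (ℓ a) → 1 ≤ n → NonEmpty (seg ℓ a n)
  seg-NonEmpty ℓ a {suc n} ne-ℓₐ _ = NonEmpty-++ (seg ℓ (suc a) n) ne-ℓₐ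

module PrefixChain {k h : ℕ} (ℓ : ℕ → Word k)
  (anti-Lyndon : ∀ m → 1 ≤ m → m ≤ h → AntiLyndon (ℓ m))
  (shrinking : ∀ m → 1 ≤ m → m < h → Prefix (ℓ (suc m)) (ℓ m)) where

  prefix-of-ℓ₁ : ∀ n → 1 ≤ n → n ≤ h → Prefix (ℓ n) (ℓ 1)
  prefix-of-ℓ₁ 1             _ _     = Prefix-refl
  prefix-of-ℓ₁ (suc (suc n)) _ n+2≤h =
    Prefix-trans (shrinking (suc n) (s≤s z≤n) n+2≤h) (prefix-of-ℓ₁ (suc n) (s≤s z≤n) (<⇒≤ n+2≤h))

  ℓ₁≢seg : ∀ a n → 1 ≤ a → 1 ≤ n → a + n ≤ suc h → ℓ 1 ≢ ℓ a → ℓ 1 ≢ seg ℓ a n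
  ℓ₁≢seg a 1 _ _ _ ℓ₁≢ℓₐ ℓ₁≡ = ℓ₁≢ℓₐ (trans ℓ₁≡ (++-identityʳ (ℓ a)))
  ℓ₁≢seg a (suc (suc n)) 1≤a _ a+n+2≤h+1 _ ℓ₁≡ =
    AntiLyndon⇒unbordered (anti-Lyndon 1 ≤-refl (≤-trans 1≤a a≤h)) ne-last ne-front
      (proj₂ (prefix-of-ℓ₁ (a + suc n) 1≤last last≤h)) (trans ℓ₁≡ (seg-snoc ℓ a (suc n)))
    where
    last≤h : a + suc n ≤ h
    last≤h = ≤-pred (subst (_≤ suc h) (+-suc a (suc n)) a+n+2≤h+1)
    a≤h : a ≤ h
    a≤h = ≤-trans (m≤m+n a (suc n)) last≤h
    1≤last : 1 ≤ a + suc n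
    1≤last = ≤-trans 1≤a (m≤m+n a (suc n))
    ne-last : NonEmpty (ℓ (a + suc n))
    ne-last = proj₁ (anti-Lyndon (a + suc n) 1≤last last≤h)
    ne-front : NonEmpty (seg ℓ a (suc n))
    ne-front = seg-NonEmpty ℓ a {suc n} (proj₁ (anti-Lyndon a 1≤a a≤h)) (s≤s z≤n)

proposition9p6 : (k : ℕ) (h i j : ℕ) (ℓ : ℕ → Word k)
    → (∀ m → 1 ≤ m → m ≤ h → AntiLyndon (ℓ m))
    → (∀ m → 1 ≤ m → m < h → Prefix (ℓ (suc m)) (ℓ m))
    → 2 ≤ h → 1 ≤ i → i < j → j < h
    → (∀ m → 1 ≤ m → m ≤ i → ℓ m ≡ ℓ 1)
    → ℓ i ≢ ℓ (suc i)
    → Prefix (seg ℓ (suc i) (j ∸ i)) (ℓ 1)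
    → ¬ Prefix (seg ℓ (suc i) (suc j ∸ i)) (ℓ 1)
    → (ℓ 1 ≪ seg ℓ (suc i) (suc j ∸ i))
      × (Σ (Word k) λ r → Σ (Word k) λ s → Σ (Word k) λ s' → Σ (Fin k) λ a → Σ (Fin k) λ b →
           (a <F b)
           × (ℓ 1 ≡ seg ℓ (suc i) (j ∸ i) ++ (r ++ (a ∷ s)))
           × (ℓ (suc j) ≡ r ++ (b ∷ s')))
proposition9p6 k h i j ℓ anti-Lyndon shrinking 2≤h 1≤i i<j j<h ℓₘ≡ℓ₁ ℓᵢ≢ℓᵢ₊₁ P⊑ℓ₁ PX⋢ℓ₁ =
  map₁ (subst (ℓ 1 ≪_) (sym seg≡PX))
    (AntiLyndon-overlap (anti-Lyndon 1 ≤-refl (<⇒≤ 2≤h)) ne-P (Prefix-≢⇒ProperPrefix P⊑ℓ₁ ℓ₁≢P)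
      (prefix-of-ℓ₁ (suc j) (s≤s z≤n) j<h) (PX⋢ℓ₁ ∘ subst (λ w → Prefix w (ℓ 1)) (sym seg≡PX)))
  where
  open PrefixChain ℓ anti-Lyndon shrinking

  P : Word k
  P = seg ℓ (suc i) (j ∸ i)

  seg≡PX : seg ℓ (suc i) (suc j ∸ i) ≡ P ++ ℓ (suc j)
  seg≡PX = seg-∸-snoc ℓ (<⇒≤ i<j)

  1≤j∸i : 1 ≤ j ∸ i
  1≤j∸i = m<n⇒0<n∸m i<j

  ne-P : NonEmpty P
  ne-P = seg-NonEmpty ℓ (suc i) (proj₁ (anti-Lyndon (suc i) (s≤s z≤n) (≤-trans i<j (<⇒≤ j<h)))) 1≤j∸i

  ℓ₁≢P : ℓ 1 ≢ P
  ℓ₁≢P = ℓ₁≢seg (suc i) (j ∸ i) (s≤s z≤n) 1≤j∸i (s≤s (subst (_≤ h) (sym (m+[n∸m]≡n (<⇒≤ i<j))) (<⇒≤ j<h)))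
           (λ ℓ₁≡ℓᵢ₊₁ → ℓᵢ≢ℓᵢ₊₁ (trans (ℓₘ≡ℓ₁ i 1≤i ≤-refl) ℓ₁≡ℓᵢ₊₁))
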